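{- Let $\alpha, \beta \in (0,1)$ be rationals, let $\mathsf{S}_1, \mathsf{S}_2, \ldots$ be positive rationals, and define $\mathsf{srtt}_1 = \mathsf{S}_1$, $\mathsf{srtt}_j = (1-\alpha)\mathsf{srtt}_{j-1} + \alpha\mathsf{S}_j$ for $j>1$, $\mathsf{rttvar}_1 = \mathsf{S}_1/2$, and $\mathsf{rttvar}_j = (1-\beta)\mathsf{rttvar}_{j-1} + \beta|\mathsf{srtt}_{j-1} - \mathsf{S}_j|$ for $j > 1$. Let $i \ge 2$ and let $c, r > 0$ be rationals such that $\mathsf{S}_j \in [c-r, c+r]$ for all $j \ge i$. Then there is a sequence of reals $(U_n)_{n \ge 0}$ with $\mathsf{rttvar}_{i+n} \le U_n$ for all $n \ge 0$ and $\lim_{n\to\infty} U_n = 2r$.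
   Context: The $\mathsf{S}_j$ are round-trip-time samples, $\mathsf{srtt}_j$ is the smoothed round-trip time and $\mathsf{rttvar}_j$ the round-trip-time variation estimate, as in the RTO computation of RFC 6298. -}

module Defs where

open import Data.Nat using (ℕ; zero; suc)
open import Data.Rational using (ℚ; 1ℚ; 0ℚ; ½; _+_; _*_; _-_; ∣_∣)

-- Sequences indexed from 1 as in the paper; index 0 is an unused junk value (0).
-- srtt α S j  =  srtt_j,   rttvar α β S j  =  rttvar_j   (j ≥ 1)
srtt : ℚ → (ℕ → ℚ) → ℕ → ℚ
srtt α S zero = 0ℚ
srtt α S (suc zero) = S 1
srtt α S (suc (suc k)) = (1ℚ - α) * srtt α S (suc k) + α * S (suc (suc k))

rttvar : ℚ → ℚ → (ℕ → ℚ) → ℕ → ℚ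
rttvar α β S zero = 0ℚ
rttvar α β S (suc zero) = S 1 * ½
rttvar α β S (suc (suc k)) =
  (1ℚ - β) * rttvar α β S (suc k) + β * ∣ srtt α S (suc k) - S (suc (suc k)) ∣

{-# OPTIONS --safe #-}
-- Let D k = ∣srtt_{i-1+k} - c∣.  The smoothed RTT is an exponentially weighted moving
-- average whose new inputs all lie within r of c, so D (k+1) ≤ (1-α) D k + α r and
-- hence D k ≤ r + qᵏ D 0 for every rate q ≥ 1 - α.  The gap ∣srtt_j - S_{j+1}∣ is
-- then at most 2r + qⁿ D 0, so rttvar is an average of the same kind with inputs
-- 2r + qⁿ D 0; for q ≥ 1 - β/2 and M = ∣rttvar_i∣ + 2 D 0 this gives
-- rttvar_{i+n} ≤ 2r + qⁿ M =: U n.  With q = max (1-α) (1-β/2) < 1 the bound U n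
-- tends to 2r, since qⁿ · n (1-q) ≤ 1.
module Submission where

open import Defs
open import Data.Nat using (ℕ)
open import Data.Rational using (ℚ; 0ℚ; 1ℚ; _+_; _*_; _-_; ∣_∣; _≤_; _<_)
open import Data.Product using (_×_; ∃-syntax; Σ-syntax)

open import Algebra.Definitions.RawSemiring Data.Rational.+-*-rawSemiring using (_^_)
import Data.Integer as ℤ
import Data.Integer.Properties as ℤ
open import Data.Integer.Tactic.RingSolver as ℤ-Solver using ()
open import Data.List using (_∷_; [])
open import Data.Maybe using (Maybe; just; nothing)
open import Data.Nat as ℕ using (zero; suc; z≤n; s≤s)
import Data.Nat.Properties as ℕ
open import Data.Product using (_,_; proj₁; proj₂; uncurry)
open import Data.Rational
  using (mkℚ; toℚᵘ; ½; -_; _⊔_; 1/_; NonZero; positive; nonNegative)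
open import Data.Rational.Properties
import Data.Rational.Unnormalised as ℚᵘ
import Data.Rational.Unnormalised.Properties as ℚᵘ
open import Data.Sum using (inj₁; inj₂)
open import Level using (0ℓ)
open import Relation.Binary.PropositionalEquality
open import Relation.Nullary using (yes; no)
open import Tactic.RingSolver using (solve; solve-∀)
open import Tactic.RingSolver.Core.AlmostCommutativeRing
  using (AlmostCommutativeRing; fromCommutativeRing)

open ≤-Reasoning

ℚ-ring : AlmostCommutativeRing 0ℓ 0ℓ
ℚ-ring = fromCommutativeRing +-*-commutativeRing 0≟_
  where
  0≟_ : ∀ p → Maybe (0ℚ ≡ p)
  0≟ p with 0ℚ ≟ p
  ... | yes 0≡p = just 0≡p
  ... | no _    = nothing

p≤q⇒0≤q-p : ∀ {p q} → p ≤ q → 0ℚ ≤ q - p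
p≤q⇒0≤q-p {p} {q} p≤q = subst (_≤ q - p) (+-inverseʳ p) (+-monoˡ-≤ (- p) p≤q)

p<q⇒0<q-p : ∀ {p q} → p < q → 0ℚ < q - p
p<q⇒0<q-p {p} {q} p<q = subst (_< q - p) (+-inverseʳ p) (+-monoˡ-< (- p) p<q)

p≤p+q : ∀ p {q} → 0ℚ ≤ q → p ≤ p + q
p≤p+q p {q} 0≤q = subst (_≤ p + q) (+-identityʳ p) (+-monoʳ-≤ p 0≤q)

p≤q+p : ∀ p {q} → 0ℚ ≤ q → p ≤ q + p
p≤q+p p {q} 0≤q = subst (_≤ q + p) (+-identityˡ p) (+-monoˡ-≤ p 0≤q)

p-q<p : ∀ p {q} → 0ℚ < q → p - q < p
p-q<p p {q} 0<q = subst (p - q <_) (+-identityʳ p) (+-monoʳ-< p (neg-antimono-< 0<q))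

0≤q⇒∣p+q-p∣≡q : ∀ p {q} → 0ℚ ≤ q → ∣ (p + q) - p ∣ ≡ q
0≤q⇒∣p+q-p∣≡q p {q} 0≤q = trans (cong ∣_∣ (p+q-p≡q p q)) (0≤p⇒∣p∣≡p 0≤q)
  where
  p+q-p≡q : ∀ p q → (p + q) - p ≡ q
  p+q-p≡q = solve-∀ ℚ-ring

p≤∣p∣ : ∀ p → p ≤ ∣ p ∣
p≤∣p∣ p with ≤-total 0ℚ p
... | inj₁ 0≤p = ≤-reflexive (sym (0≤p⇒∣p∣≡p 0≤p))
... | inj₂ p≤0 = ≤-trans p≤0 (0≤∣p∣ p)

*-monoˡ-≤-0≤ : ∀ {r p q} → 0ℚ ≤ r → p ≤ q → r * p ≤ r * q
*-monoˡ-≤-0≤ {r} 0≤r = *-monoˡ-≤-nonNeg r {{nonNegative 0≤r}}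

*-monoʳ-≤-0≤ : ∀ {r p q} → 0ℚ ≤ r → p ≤ q → p * r ≤ q * r
*-monoʳ-≤-0≤ {r} 0≤r = *-monoʳ-≤-nonNeg r {{nonNegative 0≤r}}

*-nonNeg : ∀ {p q} → 0ℚ ≤ p → 0ℚ ≤ q → 0ℚ ≤ p * q
*-nonNeg {p} 0≤p 0≤q = subst (_≤ p * _) (*-zeroʳ p) (*-monoˡ-≤-0≤ 0≤p 0≤q)

*-pos : ∀ {p q} → 0ℚ < p → 0ℚ < q → 0ℚ < p * q
*-pos {p} 0<p 0<q = subst (_< p * _) (*-zeroʳ p) (*-monoʳ-<-pos p {{positive 0<p}} 0<q)

⊔-lub-< : ∀ {p q r} → p < r → q < r → p ⊔ q < r
⊔-lub-< {p} {q} p<r q<r with ⊔-sel p q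
... | inj₁ p⊔q≡p = subst (_< _) (sym p⊔q≡p) p<r
... | inj₂ p⊔q≡q = subst (_< _) (sym p⊔q≡q) q<r

c-r≤p≤c+r⇒∣p-c∣≤r : ∀ {c r p} → c - r ≤ p → p ≤ c + r → ∣ p - c ∣ ≤ r
c-r≤p≤c+r⇒∣p-c∣≤r {c} {r} {p} c-r≤p p≤c+r with ∣p∣≡p∨∣p∣≡-p (p - c)
... | inj₁ ∣p-c∣≡p-c = begin
  ∣ p - c ∣      ≡⟨ ∣p-c∣≡p-c ⟩
  p - c          ≤⟨ +-monoˡ-≤ (- c) p≤c+r ⟩
  (c + r) - c    ≡⟨ solve (c ∷ r ∷ []) ℚ-ring ⟩
  r              ∎
... | inj₂ ∣p-c∣≡-[p-c] = begin
  ∣ p - c ∣      ≡⟨ ∣p-c∣≡-[p-c] ⟩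
  - (p - c)      ≤⟨ neg-antimono-≤ (+-monoˡ-≤ (- c) c-r≤p) ⟩
  - ((c - r) - c) ≡⟨ solve (c ∷ r ∷ []) ℚ-ring ⟩
  r              ∎

∣p-q∣≤∣p-c∣+∣q-c∣ : ∀ p q c → ∣ p - q ∣ ≤ ∣ p - c ∣ + ∣ q - c ∣
∣p-q∣≤∣p-c∣+∣q-c∣ p q c = begin
  ∣ p - q ∣                 ≡⟨ cong ∣_∣ (solve (p ∷ q ∷ c ∷ []) ℚ-ring) ⟩
  ∣ (p - c) - (q - c) ∣     ≤⟨ ∣p-q∣≤∣p∣+∣q∣ (p - c) (q - c) ⟩
  ∣ p - c ∣ + ∣ q - c ∣     ∎

∣[1-w]p+wq-c∣≤[1-w]∣p-c∣+w∣q-c∣ : ∀ {w} → 0ℚ ≤ w → w ≤ 1ℚ → ∀ p q c →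
  ∣ ((1ℚ - w) * p + w * q) - c ∣ ≤ (1ℚ - w) * ∣ p - c ∣ + w * ∣ q - c ∣
∣[1-w]p+wq-c∣≤[1-w]∣p-c∣+w∣q-c∣ {w} 0≤w w≤1 p q c = begin
  ∣ ((1ℚ - w) * p + w * q) - c ∣
    ≡⟨ cong ∣_∣ (solve (w ∷ p ∷ q ∷ c ∷ []) ℚ-ring) ⟩
  ∣ (1ℚ - w) * (p - c) + w * (q - c) ∣
    ≤⟨ ∣p+q∣≤∣p∣+∣q∣ ((1ℚ - w) * (p - c)) (w * (q - c)) ⟩
  ∣ (1ℚ - w) * (p - c) ∣ + ∣ w * (q - c) ∣
    ≡⟨ cong₂ _+_ (∣p*q∣≡∣p∣*∣q∣ (1ℚ - w) (p - c)) (∣p*q∣≡∣p∣*∣q∣ w (q - c)) ⟩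
  ∣ 1ℚ - w ∣ * ∣ p - c ∣ + ∣ w ∣ * ∣ q - c ∣
    ≡⟨ cong₂ (λ u v → u * ∣ p - c ∣ + v * ∣ q - c ∣)
         (0≤p⇒∣p∣≡p (p≤q⇒0≤q-p w≤1)) (0≤p⇒∣p∣≡p 0≤w) ⟩
  (1ℚ - w) * ∣ p - c ∣ + w * ∣ q - c ∣ ∎

fromℕ : ℕ → ℚ
fromℕ zero    = 0ℚ
fromℕ (suc n) = 1ℚ + fromℕ n

fromℕ-nonNeg : ∀ n → 0ℚ ≤ fromℕ n
fromℕ-nonNeg zero    = ≤-refl
fromℕ-nonNeg (suc n) = +-mono-≤ (nonNegative⁻¹ 1ℚ) (fromℕ-nonNeg n)

fromℕ-mono-≤ : ∀ {m n} → m ℕ.≤ n → fromℕ m ≤ fromℕ n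
fromℕ-mono-≤ {n = n} z≤n = fromℕ-nonNeg n
fromℕ-mono-≤ (s≤s m≤n)   = +-monoʳ-≤ 1ℚ (fromℕ-mono-≤ m≤n)

toℚᵘ-fromℕ : ∀ n → toℚᵘ (fromℕ n) ℚᵘ.≃ ℚᵘ.mkℚᵘ (ℤ.+ n) 0
toℚᵘ-fromℕ zero    = ℚᵘ.*≡* refl
toℚᵘ-fromℕ (suc n) = ℚᵘ.≃-trans (toℚᵘ-homo-+ 1ℚ (fromℕ n))
  (ℚᵘ.≃-trans (ℚᵘ.+-congʳ (toℚᵘ 1ℚ) (toℚᵘ-fromℕ n)) (ℚᵘ.*≡* (cross-multiplied (ℤ.+ n))))
  where
  cross-multiplied : ∀ x → (ℤ.1ℤ ℤ.* ℤ.1ℤ ℤ.+ x ℤ.* ℤ.1ℤ) ℤ.* ℤ.1ℤ ≡ (ℤ.1ℤ ℤ.+ x) ℤ.* (ℤ.1ℤ ℤ.* ℤ.1ℤ)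
  cross-multiplied = ℤ-Solver.solve-∀

<-fromℕ : ∀ p → ∃[ n ] p < fromℕ n
<-fromℕ (mkℚ a d _) = suc ℤ.∣ a ∣ ,
  toℚᵘ-cancel-< (ℚᵘ.<-respʳ-≃ (ℚᵘ.≃-sym (toℚᵘ-fromℕ (suc ℤ.∣ a ∣))) (ℚᵘ.*<* (a<1+∣a∣ a)))
  where
  a<1+∣a∣ : ∀ a → a ℤ.* ℤ.1ℤ ℤ.< ℤ.+ suc ℤ.∣ a ∣ ℤ.* ℤ.+ suc d
  a<1+∣a∣ a@(ℤ.+ k) rewrite ℤ.*-identityʳ a =
    ℤ.+<+ (ℕ.<-≤-trans (ℕ.n<1+n k) (ℕ.m≤m*n (suc k) (suc d)))
  a<1+∣a∣ a@(ℤ.-[1+ k ]) rewrite ℤ.*-identityʳ a = ℤ.-<+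

archimedean : ∀ p {t} → 0ℚ < t → ∃[ n ] p < fromℕ n * t
archimedean p {t} 0<t = n , (begin-strict
  p                  ≡⟨ *-identityʳ p ⟨
  p * 1ℚ             ≡⟨ cong (p *_) (*-inverseˡ t) ⟨
  p * (1/ t * t)     ≡⟨ *-assoc p (1/ t) t ⟨
  p * 1/ t * t       <⟨ *-monoˡ-<-pos t {{positive 0<t}} p/t<n ⟩
  fromℕ n * t        ∎)
  where
  instance
    t≢0 : NonZero t
    t≢0 = pos⇒nonZero t {{positive 0<t}}
  n : ℕ
  n = proj₁ (<-fromℕ (p * 1/ t))
  p/t<n : p * 1/ t < fromℕ n
  p/t<n = proj₂ (<-fromℕ (p * 1/ t))

^-pos : ∀ {q} → 0ℚ < q → ∀ n → 0ℚ < q ^ n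
^-pos _   zero    = positive⁻¹ 1ℚ
^-pos 0<q (suc n) = *-pos 0<q (^-pos 0<q n)

^-nonNeg : ∀ {q} → 0ℚ ≤ q → ∀ n → 0ℚ ≤ q ^ n
^-nonNeg _   zero    = nonNegative⁻¹ 1ℚ
^-nonNeg 0≤q (suc n) = *-nonNeg 0≤q (^-nonNeg 0≤q n)

^-≤-1 : ∀ {q} → 0ℚ ≤ q → q ≤ 1ℚ → ∀ n → q ^ n ≤ 1ℚ
^-≤-1 _   _   zero    = ≤-refl
^-≤-1 {q} 0≤q q≤1 (suc n) = begin
  q * q ^ n   ≤⟨ *-monoˡ-≤-0≤ 0≤q (^-≤-1 0≤q q≤1 n) ⟩
  q * 1ℚ      ≡⟨ *-identityʳ q ⟩
  q           ≤⟨ q≤1 ⟩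
  1ℚ          ∎

^-suc-≤ : ∀ {q} → 0ℚ ≤ q → q ≤ 1ℚ → ∀ n → q ^ suc n ≤ q ^ n
^-suc-≤ {q} 0≤q q≤1 n = begin
  q * q ^ n    ≤⟨ *-monoʳ-≤-0≤ (^-nonNeg 0≤q n) q≤1 ⟩
  1ℚ * q ^ n   ≡⟨ *-identityˡ (q ^ n) ⟩
  q ^ n        ∎

^-*-fromℕ-≤-1 : ∀ {q} → 0ℚ ≤ q → q ≤ 1ℚ → ∀ n → q ^ n * (fromℕ n * (1ℚ - q)) ≤ 1ℚ
^-*-fromℕ-≤-1 {q} _ _ zero = begin
  1ℚ * (0ℚ * (1ℚ - q)) ≡⟨ solve (q ∷ []) ℚ-ring ⟩
  0ℚ                   ≤⟨ nonNegative⁻¹ 1ℚ ⟩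
  1ℚ                   ∎
^-*-fromℕ-≤-1 {q} 0≤q q≤1 (suc n) = begin
  (q * q ^ n) * ((1ℚ + fromℕ n) * (1ℚ - q))
    ≡⟨ split q (q ^ n) (fromℕ n) ⟩
  q * (q ^ n * (fromℕ n * (1ℚ - q))) + (q * q ^ n) * (1ℚ - q)
    ≤⟨ +-mono-≤ (*-monoˡ-≤-0≤ 0≤q (^-*-fromℕ-≤-1 0≤q q≤1 n))
                (*-monoʳ-≤-0≤ (p≤q⇒0≤q-p q≤1) (^-≤-1 0≤q q≤1 (suc n))) ⟩
  q * 1ℚ + 1ℚ * (1ℚ - q)
    ≡⟨ solve (q ∷ []) ℚ-ring ⟩
  1ℚ ∎
  where
  split : ∀ q p x → (q * p) * ((1ℚ + x) * (1ℚ - q)) ≡ q * (p * (x * (1ℚ - q))) + (q * p) * (1ℚ - q)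
  split = solve-∀ ℚ-ring

^-*-eventually-< : ∀ {q M} → 0ℚ < q → q < 1ℚ → 0ℚ ≤ M →
  ∀ ε → 0ℚ < ε → ∃[ N ] ∀ n → N ℕ.≤ n → q ^ n * M < ε
^-*-eventually-< {q} {M} 0<q q<1 0≤M ε 0<ε = N , λ n N≤n → begin-strict
  q ^ n * M                               <⟨ *-monoʳ-<-pos (q ^ n) {{positive (^-pos 0<q n)}} (M<n[1-q]ε n N≤n) ⟩
  q ^ n * (fromℕ n * ((1ℚ - q) * ε))      ≡⟨ regroup (q ^ n) (fromℕ n) (1ℚ - q) ε ⟩
  (q ^ n * (fromℕ n * (1ℚ - q))) * ε      ≤⟨ *-monoʳ-≤-0≤ (<⇒≤ 0<ε) (^-*-fromℕ-≤-1 (<⇒≤ 0<q) (<⇒≤ q<1) n) ⟩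
  1ℚ * ε                                  ≡⟨ *-identityˡ ε ⟩
  ε                                       ∎
  where
  0<[1-q]ε : 0ℚ < (1ℚ - q) * ε
  0<[1-q]ε = *-pos (p<q⇒0<q-p q<1) 0<ε
  N : ℕ
  N = proj₁ (archimedean M 0<[1-q]ε)
  M<n[1-q]ε : ∀ n → N ℕ.≤ n → M < fromℕ n * ((1ℚ - q) * ε)
  M<n[1-q]ε n N≤n = <-≤-trans (proj₂ (archimedean M 0<[1-q]ε))
    (*-monoʳ-≤-0≤ (<⇒≤ 0<[1-q]ε) (fromℕ-mono-≤ N≤n))
  regroup : ∀ p x d e → p * (x * (d * e)) ≡ (p * (x * d)) * e
  regroup = solve-∀ ℚ-ring

p+qⁿ*M-tendsto-p : ∀ p {q M} → 0ℚ < q → q < 1ℚ → 0ℚ ≤ M →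
  ∀ ε → 0ℚ < ε → ∃[ N ] ∀ n → N ℕ.≤ n → ∣ (p + q ^ n * M) - p ∣ < ε
p+qⁿ*M-tendsto-p p {q} {M} 0<q q<1 0≤M ε 0<ε =
  N , λ n N≤n → subst (_< ε) (sym (0≤q⇒∣p+q-p∣≡q p (0≤qⁿ*M n))) (qⁿ*M<ε n N≤n)
  where
  0≤qⁿ*M : ∀ n → 0ℚ ≤ q ^ n * M
  0≤qⁿ*M n = *-nonNeg (^-nonNeg (<⇒≤ 0<q) n) 0≤M
  N : ℕ
  N = proj₁ (^-*-eventually-< 0<q q<1 0≤M ε 0<ε)
  qⁿ*M<ε : ∀ n → N ℕ.≤ n → q ^ n * M < ε
  qⁿ*M<ε = proj₂ (^-*-eventually-< 0<q q<1 0≤M ε 0<ε)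

-- The hypothesis (1 - w) M + w E ≤ q M says that one averaging step maps the
-- envelope C + qᵏ M into C + qᵏ⁺¹ M.
ewma-bound : ∀ {w q C E M} (x : ℕ → ℚ) → w ≤ 1ℚ → 0ℚ ≤ q →
  (1ℚ - w) * M + w * E ≤ q * M →
  x 0 ≤ C + M →
  (∀ k → x (suc k) ≤ (1ℚ - w) * x k + w * (C + q ^ k * E)) →
  ∀ k → x k ≤ C + q ^ k * M
ewma-bound {w} {q} {C} {E} {M} x w≤1 0≤q contract x₀≤C+M step = bound
  where
  regroup : ∀ w C p M E →
    (1ℚ - w) * (C + p * M) + w * (C + p * E) ≡ C + p * ((1ℚ - w) * M + w * E)
  regroup = solve-∀ ℚ-ring
  shift : ∀ p q M → p * (q * M) ≡ (q * p) * M
  shift = solve-∀ ℚ-ring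
  bound : ∀ k → x k ≤ C + q ^ k * M
  bound zero    = subst (λ t → x 0 ≤ C + t) (sym (*-identityˡ M)) x₀≤C+M
  bound (suc k) = begin
    x (suc k)
      ≤⟨ step k ⟩
    (1ℚ - w) * x k + w * (C + q ^ k * E)
      ≤⟨ +-monoˡ-≤ (w * (C + q ^ k * E)) (*-monoˡ-≤-0≤ (p≤q⇒0≤q-p w≤1) (bound k)) ⟩
    (1ℚ - w) * (C + q ^ k * M) + w * (C + q ^ k * E)
      ≡⟨ regroup w C (q ^ k) M E ⟩
    C + q ^ k * ((1ℚ - w) * M + w * E)
      ≤⟨ +-monoʳ-≤ C (*-monoˡ-≤-0≤ (^-nonNeg 0≤q k) contract) ⟩
    C + q ^ k * (q * M)
      ≡⟨ cong (C +_) (shift (q ^ k) q M) ⟩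
    C + (q * q ^ k) * M ∎

-- Index convention: with i = m + 2, D k is ∣srtt_{i-1+k} - c∣ and V n is rttvar_{i+n}.
module RTT-bounds (α β : ℚ) (S : ℕ → ℚ) (m : ℕ) (c r q : ℚ)
  (0≤α : 0ℚ ≤ α) (α≤1 : α ≤ 1ℚ) (0≤β : 0ℚ ≤ β) (β≤1 : β ≤ 1ℚ)
  (0≤q : 0ℚ ≤ q) (q≤1 : q ≤ 1ℚ) (1-α≤q : 1ℚ - α ≤ q) (1-β/2≤q : 1ℚ - β * ½ ≤ q)
  (S-near-c : ∀ k → ∣ S (suc (suc (k ℕ.+ m))) - c ∣ ≤ r)
  where

  D : ℕ → ℚ
  D k = ∣ srtt α S (suc (k ℕ.+ m)) - c ∣

  V : ℕ → ℚ
  V n = rttvar α β S (suc (suc (n ℕ.+ m)))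

  0≤r : 0ℚ ≤ r
  0≤r = ≤-trans (0≤∣p∣ _) (S-near-c 0)

  0≤D : ∀ k → 0ℚ ≤ D k
  0≤D k = 0≤∣p∣ _

  srtt-step : ∀ k → D (suc k) ≤ (1ℚ - α) * D k + α * r
  srtt-step k = ≤-trans (∣[1-w]p+wq-c∣≤[1-w]∣p-c∣+w∣q-c∣ 0≤α α≤1 _ _ c)
    (+-monoʳ-≤ ((1ℚ - α) * D k) (*-monoˡ-≤-0≤ 0≤α (S-near-c k)))

  srtt-bound : ∀ k → D k ≤ r + q ^ k * D 0
  srtt-bound = ewma-bound {C = r} {E = 0ℚ} D α≤1 0≤q contract (p≤q+p (D 0) 0≤r) step
    where
    contract : (1ℚ - α) * D 0 + α * 0ℚ ≤ q * D 0
    contract = begin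
      (1ℚ - α) * D 0 + α * 0ℚ  ≡⟨ cong ((1ℚ - α) * D 0 +_) (*-zeroʳ α) ⟩
      (1ℚ - α) * D 0 + 0ℚ      ≡⟨ +-identityʳ _ ⟩
      (1ℚ - α) * D 0           ≤⟨ *-monoʳ-≤-0≤ (0≤D 0) 1-α≤q ⟩
      q * D 0                  ∎
    r+p*0≡r : ∀ r p → r + p * 0ℚ ≡ r
    r+p*0≡r = solve-∀ ℚ-ring
    step : ∀ k → D (suc k) ≤ (1ℚ - α) * D k + α * (r + q ^ k * 0ℚ)
    step k = subst (λ t → D (suc k) ≤ (1ℚ - α) * D k + α * t) (sym (r+p*0≡r r (q ^ k)))
      (srtt-step k)

  srtt-sample-gap : ∀ n →
    ∣ srtt α S (suc (suc (n ℕ.+ m))) - S (suc (suc (suc (n ℕ.+ m)))) ∣ ≤ (r + r) + q ^ n * D 0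
  srtt-sample-gap n = begin
    ∣ srtt α S (suc (suc (n ℕ.+ m))) - S (suc (suc (suc (n ℕ.+ m)))) ∣
      ≤⟨ ∣p-q∣≤∣p-c∣+∣q-c∣ (srtt α S (suc (suc (n ℕ.+ m)))) (S (suc (suc (suc (n ℕ.+ m))))) c ⟩
    D (suc n) + ∣ S (suc (suc (suc (n ℕ.+ m)))) - c ∣
      ≤⟨ +-mono-≤ (srtt-bound (suc n)) (S-near-c (suc n)) ⟩
    (r + q * q ^ n * D 0) + r
      ≤⟨ +-monoˡ-≤ r (+-monoʳ-≤ r (*-monoʳ-≤-0≤ (0≤D 0) (^-suc-≤ 0≤q q≤1 n))) ⟩
    (r + q ^ n * D 0) + r
      ≡⟨ swap r (q ^ n * D 0) ⟩
    (r + r) + q ^ n * D 0 ∎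
    where
    swap : ∀ r x → (r + x) + r ≡ (r + r) + x
    swap = solve-∀ ℚ-ring

  rttvar-step : ∀ n → V (suc n) ≤ (1ℚ - β) * V n + β * ((r + r) + q ^ n * D 0)
  rttvar-step n = +-monoʳ-≤ ((1ℚ - β) * V n) (*-monoˡ-≤-0≤ 0≤β (srtt-sample-gap n))

  M : ℚ
  M = ∣ V 0 ∣ + (D 0 + D 0)

  0≤M : 0ℚ ≤ M
  0≤M = +-mono-≤ (0≤∣p∣ (V 0)) (+-mono-≤ (0≤D 0) (0≤D 0))

  rttvar-bound : ∀ n → V n ≤ (r + r) + q ^ n * M
  rttvar-bound = ewma-bound {C = r + r} {E = D 0} V β≤1 0≤q contract V₀≤2r+M rttvar-step
    where
    V₀≤2r+M : V 0 ≤ (r + r) + M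
    V₀≤2r+M = ≤-trans (p≤∣p∣ (V 0)) (≤-trans (p≤p+q ∣ V 0 ∣ (+-mono-≤ (0≤D 0) (0≤D 0)))
      (p≤q+p M (+-mono-≤ 0≤r 0≤r)))
    halve : ∀ b d → b * d ≡ (b * ½) * (d + d)
    halve = solve-∀ ℚ-ring
    merge : ∀ b M → (1ℚ - b) * M + (b * ½) * M ≡ (1ℚ - b * ½) * M
    merge = solve-∀ ℚ-ring
    contract : (1ℚ - β) * M + β * D 0 ≤ q * M
    contract = begin
      (1ℚ - β) * M + β * D 0
        ≡⟨ cong ((1ℚ - β) * M +_) (halve β (D 0)) ⟩
      (1ℚ - β) * M + (β * ½) * (D 0 + D 0)
        ≤⟨ +-monoʳ-≤ ((1ℚ - β) * M)
             (*-monoˡ-≤-0≤ (*-nonNeg 0≤β (nonNegative⁻¹ ½)) (p≤q+p (D 0 + D 0) (0≤∣p∣ (V 0)))) ⟩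
      (1ℚ - β) * M + (β * ½) * M
        ≡⟨ merge β M ⟩
      (1ℚ - β * ½) * M
        ≤⟨ *-monoʳ-≤-0≤ 0≤M 1-β/2≤q ⟩
      q * M ∎

theorem4 : (α β : ℚ) → 0ℚ < α → α < 1ℚ → 0ℚ < β → β < 1ℚ →
    (S : ℕ → ℚ) → (∀ (j : ℕ) → 1 Data.Nat.≤ j → 0ℚ < S j) →
    (i : ℕ) → 2 Data.Nat.≤ i →
    (c r : ℚ) → 0ℚ < c → 0ℚ < r →
    (∀ (j : ℕ) → i Data.Nat.≤ j → (c - r ≤ S j) × (S j ≤ c + r)) →
    Σ[ U ∈ (ℕ → ℚ) ] ((∀ (n : ℕ) → rttvar α β S (i Data.Nat.+ n) ≤ U n) ×
      (∀ (ε : ℚ) → 0ℚ < ε → Σ[ N ∈ ℕ ] (∀ (n : ℕ) → N Data.Nat.≤ n →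
        ∣ U n - (r + r) ∣ < ε)))
theorem4 _ _ _ _ _ _ _ _ zero () _ _ _ _ _
theorem4 _ _ _ _ _ _ _ _ (suc zero) (s≤s ()) _ _ _ _ _
theorem4 α β 0<α α<1 0<β β<1 S _ (suc (suc m)) _ c r _ _ S∈[c-r,c+r] =
  U , U-bounds-rttvar , U→2r
  where
  q : ℚ
  q = (1ℚ - α) ⊔ (1ℚ - β * ½)
  0<q : 0ℚ < q
  0<q = <-≤-trans (p<q⇒0<q-p α<1) (p≤p⊔q (1ℚ - α) (1ℚ - β * ½))
  q<1 : q < 1ℚ
  q<1 = ⊔-lub-< (p-q<p 1ℚ 0<α) (p-q<p 1ℚ (*-pos 0<β (positive⁻¹ ½)))
  S-near-c : ∀ k → ∣ S (suc (suc (k ℕ.+ m))) - c ∣ ≤ r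
  S-near-c k = uncurry c-r≤p≤c+r⇒∣p-c∣≤r (S∈[c-r,c+r] _ (s≤s (s≤s (ℕ.m≤n+m m k))))
  open RTT-bounds α β S m c r q (<⇒≤ 0<α) (<⇒≤ α<1) (<⇒≤ 0<β) (<⇒≤ β<1) (<⇒≤ 0<q) (<⇒≤ q<1)
    (p≤p⊔q (1ℚ - α) (1ℚ - β * ½)) (p≤q⊔p (1ℚ - α) (1ℚ - β * ½)) S-near-c
  U : ℕ → ℚ
  U n = (r + r) + q ^ n * M
  U-bounds-rttvar : ∀ n → rttvar α β S (suc (suc m) ℕ.+ n) ≤ U n
  U-bounds-rttvar n = subst (λ j → rttvar α β S (suc (suc j)) ≤ U n) (ℕ.+-comm n m) (rttvar-bound n)
  U→2r : ∀ ε → 0ℚ < ε → ∃[ N ] ∀ n → N ℕ.≤ n → ∣ U n - (r + r) ∣ < ε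
  U→2r = p+qⁿ*M-tendsto-p (r + r) 0<q q<1 0≤M
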